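{- Let $d\ge2$. For a standard ordered set partition $\mathcal S$ of $[d]$ and a nonempty subset $B\subseteq[d-1]$, we have $\sigma_{\mathcal S}^\circ\cap\nu_B^\circ\neq\emptyset$ if and only if either (1) $\mathcal S=([d])$ and $B=[d-1]$, or (2) $\mathcal S\neq([d])$ and $B\subseteq\operatorname{Type}(\mathcal S)$. As a consequence, for $P=\operatorname{Conv}\{\boldsymbol\gamma_0+\mathbf a_i:1\le i\le d-1\}$ we have $\Omega(P)=\{(\nu_B,\sigma_{\mathcal S}):\ (\mathcal S,B)\text{ satisfies (1) or (2)}\}$.
   Context: $W_{d-1}=\mathbb R^d/\mathbb R\mathbf 1$ with elements written by representatives $\mathbf w=(w_1,\dots,w_d)$; for $\mathbf w\in W_{d-1}$, $\delta_i(\mathbf w)=w_{i+1}-w_i$ ($1\le i\le d-1$). An ordered set partition $\mathcal S=(S_1,\dots,S_k)$ of $[d]$ is a list of pairwise disjoint nonempty blocks with union $[d]$; it is standard if every element of $S_i$ is smaller than every element of $S_{i+1}$; $\operatorname{Type}(\mathcal S)=\{\sum_{j\le i}|S_j|:1\le i\le k-1\}$. $\sigma_{\mathcal S}=\{\mathbf w\in W_{d-1}: w_i=w_j$ if $i,j$ lie in the same block; $w_i\le w_j$ if $i\in S_a,j\in S_b$, $a<b\}$. For nonempty $B\subseteq[d-1]$, $\nu_B=\{\mathbf w\in W_{d-1}:\delta_i(\mathbf w)=\delta_j(\mathbf w)$ for $i,j\in B$; $\delta_i(\mathbf w)\le\delta_j(\mathbf w)$ for $i\notin B,j\in B\}$.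 $(\cdot)^\circ$ is relative interior. $\mathbf a_i=-\mathbf e_i+\mathbf e_{i+1}\in\mathbb R^d$, $\boldsymbol\gamma_0=(1^2,2^2,\dots,d^2)$. $P$ lies in the affine hyperplane $U=\{\mathbf x:\sum x_i=\sum_i i^2\}$, dual to $W_{d-1}$ via the dot product; $\Sigma(P)$ is its normal fan in $W_{d-1}$ (cones $\{\mathbf w:\mathbf w\cdot\mathbf y\ge\mathbf w\cdot\mathbf y'\ \forall\mathbf y\in F,\mathbf y'\in P\}$). $\Phi_{d-1}=\{\mathbf w\in W_{d-1}:w_1\le\dots\le w_d\}$ and $\Sigma(\Phi_{d-1})$ is its set of nonempty faces, which are exactly the $\sigma_{\mathcal S}$ for standard $\mathcal S$. $\Omega(P)=\{(\sigma,\phi)\in\Sigma(P)\times\Sigma(\Phi_{d-1}):\sigma^\circ\cap\phi^\circ\ne\emptyset\}$.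
   Formalization: The representatives of points of $W_{d-1}$, the polytope P, the cones and their relative interiors all lie in ℚ^d instead of ℝ^d. -}

module Defs where

open import Level using (0ℓ)
open import Data.Nat as ℕ using (ℕ; zero; suc)
open import Data.Fin as Fin using (Fin; zero; suc; toℕ; inject₁)
open import Data.Fin.Subset using (Subset; _∈_; _∉_; Nonempty)
open import Data.Integer using (+_)
open import Data.Rational using (ℚ; 0ℚ; 1ℚ; _+_; _*_; _-_; -_; ∣_∣; _/_; _≤_; _<_)
open import Data.Bool using (if_then_else_)
open import Data.Product using (Σ; ∃; ∃-syntax; _×_; _,_)
open import Relation.Nullary using (¬_; does)
open import Relation.Binary.PropositionalEquality using (_≡_)
open import Function.Bundles using (_⇔_)

-- Points of ℝ^d are modelled by rational vectors Fin d → ℚ.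

Vecℚ : ℕ → Set
Vecℚ d = Fin d → ℚ

Cone : ℕ → Set₁
Cone d = Vecℚ d → Set

sumF : ∀ {m} → (Fin m → ℚ) → ℚ
sumF {zero}  f = 0ℚ
sumF {suc m} f = f zero + sumF (λ i → f (suc i))

sumℕ : ∀ {m} → (Fin m → ℕ) → ℕ
sumℕ {zero}  f = 0
sumℕ {suc m} f = f zero ℕ.+ sumℕ (λ i → f (suc i))

_·_ : ∀ {d} → Vecℚ d → Vecℚ d → ℚ
u · v = sumF (λ i → u i * v i)

_≐_ : ∀ {d} → Cone d → Cone d → Set
C ≐ D = ∀ w → (C w → D w) × (D w → C w)

aff : ∀ {d} → Cone d → Cone d
aff {d} C y =
  ∃[ m ] Σ (Fin m → ℚ) λ c → Σ (Fin m → Vecℚ d) λ p →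
    (∀ j → C (p j)) × sumF c ≡ 1ℚ × (∀ i → y i ≡ sumF (λ j → c j * p j i))

relint : ∀ {d} → Cone d → Cone d
relint {d} C x =
  C x × ∃[ ε ] (0ℚ < ε × (∀ y → aff C y → (∀ i → ∣ y i - x i ∣ < ε) → C y))

-- Ordered set partitions of [d] = Fin d, encoded by the block map:
-- the blocks are S_j = blk⁻¹(j), j : Fin k (0-indexed), all nonempty.

record OSP (d : ℕ) : Set where
  field
    k    : ℕ
    blk  : Fin d → Fin k
    surj : ∀ j → ∃[ x ] blk x ≡ j
open OSP public

Standard : ∀ {d} → OSP d → Set
Standard {d} S = ∀ (x y : Fin d) → toℕ (blk S y) ≡ suc (toℕ (blk S x)) → x Fin.< y

blockSize : ∀ {d} (S : OSP d) → Fin (k S) → ℕ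
blockSize {d} S j = sumℕ (λ (x : Fin d) → if does (blk S x Fin.≟ j) then 1 else 0)

-- Σ_{j ≤ i} |S_j|  (1-indexed blocks, i.e. 0-indexed blocks j < i)
prefixSize : ∀ {d} (S : OSP d) → ℕ → ℕ
prefixSize S i = sumℕ (λ j → if does (toℕ j ℕ.<? i) then blockSize S j else 0)

Type : ∀ {d} → OSP d → ℕ → Set
Type S m = ∃[ i ] (1 ℕ.≤ i × i ℕ.< k S × m ≡ prefixSize S i)

IsTrivial : ∀ {d} → OSP d → Set
IsTrivial S = k S ≡ 1

σ : ∀ {d} → OSP d → Cone d
σ S w = (∀ i j → blk S i ≡ blk S j → w i ≡ w j)
      × (∀ i j → blk S i Fin.< blk S j → w i ≤ w j)

-- From here on d = suc n, and [d-1] is modelled by Fin n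
-- (i : Fin n stands for the index toℕ i + 1 ∈ [d-1]).

δ : ∀ {n} → Fin n → Vecℚ (suc n) → ℚ
δ i w = w (suc i) - w (inject₁ i)

ν : ∀ {n} → Subset n → Cone (suc n)
ν B w = (∀ i j → i ∈ B → j ∈ B → δ i w ≡ δ j w)
      × (∀ i j → i ∉ B → j ∈ B → δ i w ≤ δ j w)

_⊆Type_ : ∀ {n} → Subset n → OSP (suc n) → Set
B ⊆Type S = ∀ i → i ∈ B → Type S (suc (toℕ i))

Cond : ∀ {n} → OSP (suc n) → Subset n → Set
Cond {n} S B = (IsTrivial S × (∀ (i : Fin n) → i ∈ B))
             Data.Sum.⊎ (¬ IsTrivial S × B ⊆Type S)
  where import Data.Sum

ℕtoℚ : ℕ → ℚ
ℕtoℚ m = (+ m) / 1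

γ₀ : ∀ {d} → Vecℚ d
γ₀ j = ℕtoℚ (suc (toℕ j) ℕ.* suc (toℕ j))

a : ∀ {n} → Fin n → Vecℚ (suc n)
a i j = if does (toℕ j ℕ.≟ toℕ i) then - 1ℚ
        else (if does (toℕ j ℕ.≟ suc (toℕ i)) then 1ℚ else 0ℚ)

vert : ∀ {n} → Fin n → Vecℚ (suc n)
vert i j = γ₀ j + a i j

inP : ∀ {n} → Cone (suc n)
inP {n} x = Σ (Fin n → ℚ) λ l →
  (∀ i → 0ℚ ≤ l i) × sumF l ≡ 1ℚ × (∀ j → x j ≡ sumF (λ i → l i * vert i j))

-- the face of P on which the linear functional u is maximised
-- (every nonempty face of P is of this form)
Face : ∀ {n} → Vecℚ (suc n) → Cone (suc n)
Face u y = inP y × (∀ y' → inP y' → u · y' ≤ u · y)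

NormalCone : ∀ {n} → Cone (suc n) → Cone (suc n)
NormalCone F w = ∀ y y' → F y → inP y' → w · y' ≤ w · y

InΣP : ∀ {n} → Cone (suc n) → Set
InΣP {n} C = Σ (Vecℚ (suc n)) λ u → C ≐ NormalCone (Face u)

InΣΦ : ∀ {d} → Cone d → Set
InΣΦ {d} φ = Σ (OSP d) λ S → Standard S × (φ ≐ σ S)

InΩ : ∀ {n} → Cone (suc n) → Cone (suc n) → Set
InΩ C φ = InΣP C × InΣΦ φ × ∃[ w ] (relint C w × relint φ w)

{-# OPTIONS --safe #-}
module Submission where

open import Defs
open import Data.Nat using (ℕ; suc; _≤_)
open import Data.Fin.Subset using (Subset; Nonempty)
open import Data.Product using (Σ; ∃; ∃-syntax; _×_)
open import Function.Bundles using (_⇔_)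

import Algebra.Properties.CommutativeMonoid.Sum as CommutativeMonoidSum
import Algebra.Properties.Semiring.Sum as SemiringSum
open import Algebra.Bundles using (CommutativeRing)
open import Data.Bool using (Bool; true; false; if_then_else_)
open import Data.Bool.Properties using (if-swap-then)
open import Data.Empty using (⊥-elim)
open import Data.Fin as Fin using (Fin; zero; suc; toℕ; inject₁; fromℕ<)
import Data.Fin.Properties as Finₚ
open import Data.Fin.Subset using (_∈_; _∉_)
open import Data.Fin.Subset.Properties using (_∈?_)
open import Data.Nat as ℕ using (zero; z≤n; s≤s; _<_; _<?_)
import Data.Nat.Properties as ℕₚ
open import Data.Product using (_,_; proj₁; proj₂; ∃₂)
open import Data.Rational using (ℚ; 0ℚ; 1ℚ; ½; _+_; _*_; _-_; -_; ∣_∣; positive; nonNegative)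
  renaming (_≤_ to _≤ℚ_; _<_ to _<ℚ_)
import Data.Rational.Properties as ℚₚ
open import Data.Rational.Solver using (module +-*-Solver)
open +-*-Solver using (solve; _:=_; _:+_; _:*_; _:-_; :-_; con)
open import Data.Sum using (_⊎_; inj₁; inj₂)
open import Data.Vec using (tabulate)
import Data.Vec.Properties as Vecₚ
open import Function.Bundles using (mk⇔)
open import Level using (0ℓ)
open import Relation.Binary.Definitions using (tri<; tri≈; tri>)
open import Relation.Binary.PropositionalEquality
open import Relation.Nullary using (¬_; Dec; yes; no; does)
open import Relation.Nullary.Decidable using (dec-true; dec-false; does-⇔; from-yes)
open import Relation.Unary using (Pred; Decidable)

-- For y = Σ lᵢ (γ₀ + aᵢ) in P one has w · y = w · γ₀ + Σ lᵢ δᵢ(w), so the face of P maximising u is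
-- spanned by the vertices γ₀ + aᵢ with i in the set B where δ(u) is maximal, and its normal cone is ν_B.
-- A point w in the relative interior of σ_S is constant on blocks and strictly increasing across them:
-- δᵢ(w) = 0 when i, i+1 share a block and δᵢ(w) > 0 at a block boundary. In the relative interior of
-- ν_B, δ(w) is maximal exactly on B. Hence either S is a single block and B = [d-1], or every element
-- of B is a block boundary, and the boundaries are exactly Type(S). Conversely, if B consists of
-- boundaries, the block index plus the partial sums of the indicator of B is a common relative-interior
-- point, and if S is a single block and B = [d-1], so is 0.

p≤∣p∣ : ∀ p → p ≤ℚ ∣ p ∣
p≤∣p∣ p with ℚₚ.∣p∣≡p∨∣p∣≡-p p
... | inj₁ ∣p∣≡p  = ℚₚ.≤-reflexive (sym ∣p∣≡p)
... | inj₂ ∣p∣≡-p = ℚₚ.≤-trans p≤0 (ℚₚ.0≤∣p∣ p)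
  where
  p≤0 : p ≤ℚ 0ℚ
  p≤0 = subst (_≤ℚ 0ℚ) (solve 1 (λ p → :- (:- p) := p) refl p)
          (ℚₚ.neg-antimono-≤ (subst (0ℚ ≤ℚ_) ∣p∣≡-p (ℚₚ.0≤∣p∣ p)))

∣p-q∣<ε⇒p<q+ε : ∀ {p q ε} → ∣ p - q ∣ <ℚ ε → p <ℚ q + ε
∣p-q∣<ε⇒p<q+ε {p} {q} {ε} h = subst₂ _<ℚ_
  (solve 2 (λ p q → (p :- q) :+ q := p) refl p q) (ℚₚ.+-comm ε q)
  (ℚₚ.+-monoˡ-< q (ℚₚ.≤-<-trans (p≤∣p∣ (p - q)) h))

∣p-q∣<ε⇒q-ε<p : ∀ {p q ε} → ∣ p - q ∣ <ℚ ε → q - ε <ℚ p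
∣p-q∣<ε⇒q-ε<p {p} {q} {ε} h = subst₂ _<ℚ_
  (solve 3 (λ p q ε → (q :- p) :+ (p :- ε) := q :- ε) refl p q ε)
  (solve 2 (λ p ε → ε :+ (p :- ε) := p) refl p ε)
  (ℚₚ.+-monoˡ-< (p - ε) (ℚₚ.≤-<-trans (p≤∣p∣ (q - p)) ∣q-p∣<ε))
  where
  ∣q-p∣<ε : ∣ q - p ∣ <ℚ ε
  ∣q-p∣<ε = subst (_<ℚ ε)
    (trans (sym (ℚₚ.∣-p∣≡∣p∣ (p - q))) (cong ∣_∣ (solve 2 (λ p q → :- (p :- q) := q :- p) refl p q))) h

gap-stable : ∀ {a b a′ b′} → a + 1ℚ ≤ℚ b → ∣ a′ - a ∣ <ℚ ½ → ∣ b′ - b ∣ <ℚ ½ → a′ ≤ℚ b′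
gap-stable {a} {b} {a′} {b′} gap a′≈a b′≈b = ℚₚ.<⇒≤ (begin-strict
  a′           <⟨ ∣p-q∣<ε⇒p<q+ε a′≈a ⟩
  a + ½        ≡⟨ solve 1 (λ a → a :+ con ½ := (a :+ con 1ℚ) :- con ½) refl a ⟩
  a + 1ℚ - ½   ≤⟨ ℚₚ.+-monoˡ-≤ (- ½) gap ⟩
  b - ½        <⟨ ∣p-q∣<ε⇒q-ε<p b′≈b ⟩
  b′           ∎)
  where open ℚₚ.≤-Reasoning

+-cancelˡ-≤ : ∀ a {p q} → a + p ≤ℚ a + q → p ≤ℚ q
+-cancelˡ-≤ a {p} {q} h = subst₂ _≤ℚ_ (cancel p) (cancel q) (ℚₚ.+-monoʳ-≤ (- a) h)
  where
  cancel : ∀ x → - a + (a + x) ≡ x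
  cancel x = solve 2 (λ a x → :- a :+ (a :+ x) := x) refl a x

p≤q⇒0≤q-p : ∀ {p q} → p ≤ℚ q → 0ℚ ≤ℚ q - p
p≤q⇒0≤q-p {p} {q} p≤q = subst (_≤ℚ q - p) (ℚₚ.+-inverseʳ p) (ℚₚ.+-monoˡ-≤ (- p) p≤q)

p<q⇒0<q-p : ∀ {p q} → p <ℚ q → 0ℚ <ℚ q - p
p<q⇒0<q-p {p} {q} p<q = subst (_<ℚ q - p) (ℚₚ.+-inverseʳ p) (ℚₚ.+-monoˡ-< (- p) p<q)

0≤q-p⇒p≤q : ∀ {p q} → 0ℚ ≤ℚ q - p → p ≤ℚ q
0≤q-p⇒p≤q {p} {q} h = subst₂ _≤ℚ_ (ℚₚ.+-identityˡ p) (solve 2 (λ q p → (q :- p) :+ p := q) refl q p) (ℚₚ.+-monoˡ-≤ p h)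

p+1≤q⇒p≤q : ∀ {p q} → p + 1ℚ ≤ℚ q → p ≤ℚ q
p+1≤q⇒p≤q {p} h = ℚₚ.≤-trans p≤p+1 h
  where
  p≤p+1 : p ≤ℚ p + 1ℚ
  p≤p+1 = subst (_≤ℚ p + 1ℚ) (ℚₚ.+-identityʳ p) (ℚₚ.+-monoʳ-≤ p (ℚₚ.nonNegative⁻¹ 1ℚ))

p+t*1≤q+t*0⇒p<q : ∀ {p q t} → 0ℚ <ℚ t → p + t * 1ℚ ≤ℚ q + t * 0ℚ → p <ℚ q
p+t*1≤q+t*0⇒p<q {p} {q} {t} t>0 h = begin-strict
  p           ≡⟨ sym (ℚₚ.+-identityʳ p) ⟩
  p + 0ℚ      <⟨ ℚₚ.+-monoʳ-< p t>0 ⟩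
  p + t       ≡⟨ cong (p +_) (sym (ℚₚ.*-identityʳ t)) ⟩
  p + t * 1ℚ  ≤⟨ h ⟩
  q + t * 0ℚ  ≡⟨ solve 2 (λ q t → q :+ t :* con 0ℚ := q) refl q t ⟩
  q           ∎
  where open ℚₚ.≤-Reasoning

fromℕ : ℕ → ℚ
fromℕ zero    = 0ℚ
fromℕ (suc m) = 1ℚ + fromℕ m

fromℕ-nonNeg : ∀ m → 0ℚ ≤ℚ fromℕ m
fromℕ-nonNeg zero    = ℚₚ.≤-refl
fromℕ-nonNeg (suc m) = ℚₚ.+-mono-≤ (ℚₚ.nonNegative⁻¹ 1ℚ) (fromℕ-nonNeg m)

fromℕ-+1≤ : ∀ {m m′} → m < m′ → fromℕ m + 1ℚ ≤ℚ fromℕ m′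
fromℕ-+1≤ {zero}  {suc m′} _ = subst (_≤ℚ 1ℚ + fromℕ m′) (ℚₚ.+-identityʳ 1ℚ) (ℚₚ.+-monoʳ-≤ 1ℚ (fromℕ-nonNeg m′))
fromℕ-+1≤ {suc m} {suc m′} (s≤s m<m′) =
  subst (_≤ℚ fromℕ (suc m′)) (sym (ℚₚ.+-assoc 1ℚ (fromℕ m) 1ℚ)) (ℚₚ.+-monoʳ-≤ 1ℚ (fromℕ-+1≤ m<m′))

𝟙 : Bool → ℚ
𝟙 b = if b then 1ℚ else 0ℚ

𝟙-nonNeg : ∀ b → 0ℚ ≤ℚ 𝟙 b
𝟙-nonNeg true  = ℚₚ.nonNegative⁻¹ 1ℚ
𝟙-nonNeg false = ℚₚ.≤-refl

p-𝟙≤p : ∀ p b → p - 𝟙 b ≤ℚ p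
p-𝟙≤p p true  = subst (p - 1ℚ ≤ℚ_) (ℚₚ.+-identityʳ p) (ℚₚ.+-monoʳ-≤ p (ℚₚ.neg-antimono-≤ (𝟙-nonNeg true)))
p-𝟙≤p p false = ℚₚ.≤-reflexive (ℚₚ.+-identityʳ p)

𝟙-mono : ∀ {P Q : Set} → (P → Q) → (P? : Dec P) (Q? : Dec Q) → 𝟙 (does P?) ≤ℚ 𝟙 (does Q?)
𝟙-mono P⇒Q (yes p) Q? = ℚₚ.≤-reflexive (cong 𝟙 (sym (dec-true Q? (P⇒Q p))))
𝟙-mono P⇒Q (no _)  Q? = 𝟙-nonNeg (does Q?)

module ∑ℚ = SemiringSum (CommutativeRing.semiring ℚₚ.+-*-commutativeRing)

sumF≡sum : ∀ {m} (f : Fin m → ℚ) → sumF f ≡ ∑ℚ.sum f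
sumF≡sum {zero}  f = refl
sumF≡sum {suc m} f = cong (f zero +_) (sumF≡sum (λ i → f (suc i)))

sumF-zero : ∀ m → sumF {m} (λ _ → 0ℚ) ≡ 0ℚ
sumF-zero m = trans (sumF≡sum {m} (λ _ → 0ℚ)) (∑ℚ.sum-replicate-zero m)

sumF-cong : ∀ {m} {f g : Fin m → ℚ} → (∀ i → f i ≡ g i) → sumF f ≡ sumF g
sumF-cong {zero}  f≗g = refl
sumF-cong {suc m} f≗g = cong₂ _+_ (f≗g zero) (sumF-cong (λ i → f≗g (suc i)))

sumF-+ : ∀ {m} (f g : Fin m → ℚ) → sumF (λ i → f i + g i) ≡ sumF f + sumF g
sumF-+ f g = begin
  sumF (λ i → f i + g i)      ≡⟨ sumF≡sum (λ i → f i + g i) ⟩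
  ∑ℚ.sum (λ i → f i + g i)    ≡⟨ ∑ℚ.∑-distrib-+ f g ⟩
  ∑ℚ.sum f + ∑ℚ.sum g         ≡⟨ sym (cong₂ _+_ (sumF≡sum f) (sumF≡sum g)) ⟩
  sumF f + sumF g             ∎
  where open ≡-Reasoning

sumF-*ˡ : ∀ {m} c (f : Fin m → ℚ) → sumF (λ i → c * f i) ≡ c * sumF f
sumF-*ˡ c f = begin
  sumF (λ i → c * f i)        ≡⟨ sumF≡sum (λ i → c * f i) ⟩
  ∑ℚ.sum (λ i → c * f i)      ≡⟨ sym (∑ℚ.*-distribˡ-sum c f) ⟩
  c * ∑ℚ.sum f                ≡⟨ cong (c *_) (sym (sumF≡sum f)) ⟩
  c * sumF f                  ∎
  where open ≡-Reasoning

sumF-*ʳ : ∀ {m} c (f : Fin m → ℚ) → sumF (λ i → f i * c) ≡ sumF f * c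
sumF-*ʳ c f = begin
  sumF (λ i → f i * c)        ≡⟨ sumF≡sum (λ i → f i * c) ⟩
  ∑ℚ.sum (λ i → f i * c)      ≡⟨ sym (∑ℚ.*-distribʳ-sum c f) ⟩
  ∑ℚ.sum f * c                ≡⟨ cong (_* c) (sym (sumF≡sum f)) ⟩
  sumF f * c                  ∎
  where open ≡-Reasoning

sumF-comm : ∀ {m p} (F : Fin m → Fin p → ℚ) →
            sumF (λ i → sumF (F i)) ≡ sumF (λ j → sumF (λ i → F i j))
sumF-comm F = begin
  sumF (λ i → sumF (F i))                  ≡⟨ nested F ⟩
  ∑ℚ.sum (λ i → ∑ℚ.sum (F i))              ≡⟨ ∑ℚ.∑-comm F ⟩
  ∑ℚ.sum (λ j → ∑ℚ.sum (λ i → F i j))      ≡⟨ sym (nested (λ j i → F i j)) ⟩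
  sumF (λ j → sumF (λ i → F i j))          ∎
  where
  open ≡-Reasoning
  nested : ∀ {m p} (G : Fin m → Fin p → ℚ) → sumF (λ i → sumF (G i)) ≡ ∑ℚ.sum (λ i → ∑ℚ.sum (G i))
  nested G = trans (sumF-cong (λ i → sumF≡sum (G i))) (sumF≡sum (λ i → ∑ℚ.sum (G i)))

sumF-- : ∀ {m} (f g : Fin m → ℚ) → sumF (λ i → f i - g i) ≡ sumF f - sumF g
sumF-- {zero}  f g = refl
sumF-- {suc m} f g = trans (cong (f zero - g zero +_) (sumF-- (λ i → f (suc i)) (λ i → g (suc i))))
  (solve 4 (λ a b c d → (a :- b) :+ (c :- d) := (a :+ c) :- (b :+ d)) refl
     (f zero) (g zero) (sumF (λ i → f (suc i))) (sumF (λ i → g (suc i))))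

sumF-mono : ∀ {m} {f g : Fin m → ℚ} → (∀ i → f i ≤ℚ g i) → sumF f ≤ℚ sumF g
sumF-mono {zero}  f≤g = ℚₚ.≤-refl
sumF-mono {suc m} f≤g = ℚₚ.+-mono-≤ (f≤g zero) (sumF-mono (λ i → f≤g (suc i)))

sumF-nonNeg : ∀ {m} {f : Fin m → ℚ} → (∀ i → 0ℚ ≤ℚ f i) → 0ℚ ≤ℚ sumF f
sumF-nonNeg {zero}  f≥0 = ℚₚ.≤-refl
sumF-nonNeg {suc m} f≥0 = ℚₚ.+-mono-≤ (f≥0 zero) (sumF-nonNeg (λ i → f≥0 (suc i)))

term≤sumF : ∀ {m} {f : Fin m → ℚ} → (∀ i → 0ℚ ≤ℚ f i) → ∀ i → f i ≤ℚ sumF f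
term≤sumF {suc m} {f} f≥0 zero = subst (_≤ℚ sumF f) (ℚₚ.+-identityʳ (f zero))
  (ℚₚ.+-monoʳ-≤ (f zero) (sumF-nonNeg (λ i → f≥0 (suc i))))
term≤sumF {suc m} {f} f≥0 (suc i) = subst (_≤ℚ sumF f) (ℚₚ.+-identityˡ (f (suc i)))
  (ℚₚ.+-mono-≤ (f≥0 zero) (term≤sumF (λ j → f≥0 (suc j)) i))

𝐞 : ∀ {m} → Fin m → Fin m → ℚ
𝐞 i j = 𝟙 (does (j Fin.≟ i))

𝐞·-select : ∀ {m} (i : Fin m) (f : Fin m → ℚ) → 𝐞 i · f ≡ f i
𝐞·-select {suc m} zero f = begin
  1ℚ * f zero + sumF (λ j → 0ℚ * f (suc j))
    ≡⟨ cong₂ _+_ (ℚₚ.*-identityˡ (f zero)) (sumF-cong (λ j → ℚₚ.*-zeroˡ (f (suc j)))) ⟩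
  f zero + sumF {m} (λ _ → 0ℚ)   ≡⟨ cong (f zero +_) (sumF-zero m) ⟩
  f zero + 0ℚ                    ≡⟨ ℚₚ.+-identityʳ (f zero) ⟩
  f zero                         ∎
  where open ≡-Reasoning
𝐞·-select {suc m} (suc i) f =
  trans (cong₂ _+_ (ℚₚ.*-zeroˡ (f zero)) (𝐞·-select i (λ j → f (suc j)))) (ℚₚ.+-identityˡ (f (suc i)))

module ∑ℕ = CommutativeMonoidSum ℕₚ.+-0-commutativeMonoid

sumℕ≡sum : ∀ {m} (f : Fin m → ℕ) → sumℕ f ≡ ∑ℕ.sum f
sumℕ≡sum {zero}  f = refl
sumℕ≡sum {suc m} f = cong (f zero ℕ.+_) (sumℕ≡sum (λ i → f (suc i)))

sumℕ-cong : ∀ {m} {f g : Fin m → ℕ} → (∀ i → f i ≡ g i) → sumℕ f ≡ sumℕ g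
sumℕ-cong {zero}  f≗g = refl
sumℕ-cong {suc m} f≗g = cong₂ ℕ._+_ (f≗g zero) (sumℕ-cong (λ i → f≗g (suc i)))

sumℕ-mono : ∀ {m} {f g : Fin m → ℕ} → (∀ i → f i ≤ g i) → sumℕ f ≤ sumℕ g
sumℕ-mono {zero}  f≤g = z≤n
sumℕ-mono {suc m} f≤g = ℕₚ.+-mono-≤ (f≤g zero) (sumℕ-mono (λ i → f≤g (suc i)))

sum-select : ∀ {m} (c : Fin m) (g : Fin m → ℕ) → ∑ℕ.sum (λ b → if does (c Fin.≟ b) then g b else 0) ≡ g c
sum-select {suc m} zero    g = trans (cong (g zero ℕ.+_) (∑ℕ.sum-replicate-zero m)) (ℕₚ.+-identityʳ (g zero))
sum-select {suc m} (suc c) g = sum-select c (λ b → g (suc b))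

if-sum : ∀ {m} b (F : Fin m → ℕ) → (if b then ∑ℕ.sum F else 0) ≡ ∑ℕ.sum (λ x → if b then F x else 0)
if-sum     true  F = refl
if-sum {m} false F = sym (∑ℕ.sum-replicate-zero m)

δ-- : ∀ {n} (v h : Vecℚ (suc n)) k → δ k (λ x → v x - h x) ≡ δ k v - δ k h
δ-- v h k = solve 4 (λ a b c d → (a :- b) :- (c :- d) := (a :- c) :- (b :- d)) refl
              (v (suc k)) (h (suc k)) (v (inject₁ k)) (h (inject₁ k))

δ-+ : ∀ {n} (v h : Vecℚ (suc n)) k → δ k (λ x → v x + h x) ≡ δ k v + δ k h
δ-+ v h k = solve 4 (λ a b c d → (a :+ b) :- (c :+ d) := (a :- c) :+ (b :- d)) refl
              (v (suc k)) (h (suc k)) (v (inject₁ k)) (h (inject₁ k))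

δ-+* : ∀ {n} (v h : Vecℚ (suc n)) t k → δ k (λ x → v x + t * h x) ≡ δ k v + t * δ k h
δ-+* v h t k = solve 5 (λ a b c d t → (a :+ t :* b) :- (c :+ t :* d) := (a :- c) :+ t :* (b :- d)) refl
                 (v (suc k)) (h (suc k)) (v (inject₁ k)) (h (inject₁ k)) t

δ≥0⇒mono : ∀ {n} (v : Vecℚ (suc n)) → (∀ i → 0ℚ ≤ℚ δ i v) → ∀ {x z} → toℕ x ≤ toℕ z → v x ≤ℚ v z
δ≥0⇒mono         v δ≥0 {zero}  {zero}  _         = ℚₚ.≤-refl
δ≥0⇒mono {suc n} v δ≥0 {zero}  {suc z} _         =
  ℚₚ.≤-trans (0≤q-p⇒p≤q (δ≥0 zero)) (δ≥0⇒mono (λ y → v (suc y)) (λ i → δ≥0 (suc i)) {zero} {z} z≤n)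
δ≥0⇒mono {suc n} v δ≥0 {suc x} {suc z} (s≤s x≤z) = δ≥0⇒mono (λ y → v (suc y)) (λ i → δ≥0 (suc i)) x≤z

partialSums : ∀ {n} → (Fin n → ℚ) → Vecℚ (suc n)
partialSums f zero = 0ℚ
partialSums {suc n} f (suc x) = f zero + partialSums (λ i → f (suc i)) x

δ-partialSums : ∀ {n} (f : Fin n → ℚ) i → δ i (partialSums f) ≡ f i
δ-partialSums {suc n} f zero = solve 1 (λ a → (a :+ con 0ℚ) :- con 0ℚ := a) refl (f zero)
δ-partialSums {suc n} f (suc i) = trans
  (solve 3 (λ a b c → (a :+ b) :- (a :+ c) := b :- c) refl
     (f zero) (partialSums (λ j → f (suc j)) (suc i)) (partialSums (λ j → f (suc j)) (inject₁ i)))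
  (δ-partialSums (λ j → f (suc j)) i)

indicator : ∀ {n} → Subset n → Fin n → ℚ
indicator B i = 𝟙 (does (i ∈? B))

after : ∀ {n} → Fin n → Fin (suc n) → Bool
after j x = does (toℕ j <? toℕ x)

δ-𝟙after : ∀ {n} (j k : Fin n) → δ k (λ x → 𝟙 (after j x)) ≡ 𝟙 (does (k Fin.≟ j))
δ-𝟙after j k = trans
  (cong (λ m → 𝟙 (does (toℕ j <? suc (toℕ k))) - 𝟙 (does (toℕ j <? m))) (Finₚ.toℕ-inject₁ k))
  (jump (k Fin.≟ j))
  where
  jump : (k≟j : Dec (k ≡ j)) → 𝟙 (does (toℕ j <? suc (toℕ k))) - 𝟙 (does (toℕ j <? toℕ k)) ≡ 𝟙 (does k≟j)
  jump (yes refl) rewrite dec-true (toℕ k <? suc (toℕ k)) (ℕₚ.n<1+n (toℕ k))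
                        | dec-false (toℕ k <? toℕ k) (ℕₚ.<-irrefl refl) = refl
  jump (no k≢j) = trans (cong (λ b → 𝟙 b - 𝟙 (does (toℕ j <? toℕ k))) (does-⇔ j<k⇔ (toℕ j <? suc (toℕ k)) (toℕ j <? toℕ k)))
                        (ℚₚ.+-inverseʳ (𝟙 (does (toℕ j <? toℕ k))))
    where
    j<k⇔ : toℕ j < suc (toℕ k) ⇔ toℕ j < toℕ k
    j<k⇔ = mk⇔ (λ j≤k → ℕₚ.≤∧≢⇒< (ℕ.s≤s⁻¹ j≤k) (λ j≡k → k≢j (Finₚ.toℕ-injective (sym j≡k)))) ℕₚ.m<n⇒m<1+n

-- Convex combinations and the polytope P

·-comm : ∀ {d} (u v : Vecℚ d) → u · v ≡ v · u
·-comm u v = sumF-cong (λ i → ℚₚ.*-comm (u i) (v i))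

·a≡δ : ∀ {n} (w : Vecℚ (suc n)) (i : Fin n) → w · a i ≡ δ i w
·a≡δ {suc n} w zero = begin
  w zero * - 1ℚ + (w (suc zero) * 1ℚ + sumF (λ j → w (suc (suc j)) * 0ℚ))
    ≡⟨ cong (λ z → w zero * - 1ℚ + (w (suc zero) * 1ℚ + z))
         (trans (sumF-cong (λ j → ℚₚ.*-zeroʳ (w (suc (suc j))))) (sumF-zero n)) ⟩
  w zero * - 1ℚ + (w (suc zero) * 1ℚ + 0ℚ)
    ≡⟨ solve 2 (λ x y → x :* (:- con 1ℚ) :+ (y :* con 1ℚ :+ con 0ℚ) := y :- x) refl (w zero) (w (suc zero)) ⟩
  δ zero w ∎
  where open ≡-Reasoning
·a≡δ {suc n} w (suc i) =
  trans (cong₂ _+_ (ℚₚ.*-zeroʳ (w zero)) (·a≡δ (λ j → w (suc j)) i)) (ℚₚ.+-identityˡ _)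

·vert : ∀ {n} (w : Vecℚ (suc n)) (i : Fin n) → w · vert i ≡ w · γ₀ + δ i w
·vert w i = begin
  sumF (λ j → w j * (γ₀ j + a i j))          ≡⟨ sumF-cong (λ j → ℚₚ.*-distribˡ-+ (w j) (γ₀ j) (a i j)) ⟩
  sumF (λ j → w j * γ₀ j + w j * a i j)      ≡⟨ sumF-+ (λ j → w j * γ₀ j) (λ j → w j * a i j) ⟩
  w · γ₀ + w · a i                           ≡⟨ cong (w · γ₀ +_) (·a≡δ w i) ⟩
  w · γ₀ + δ i w                             ∎
  where open ≡-Reasoning

·-combination : ∀ {d m} (κ : Vecℚ d) {y : Vecℚ d} {c : Fin m → ℚ} {p : Fin m → Vecℚ d} →
                (∀ i → y i ≡ sumF (λ j → c j * p j i)) → κ · y ≡ sumF (λ j → c j * (κ · p j))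
·-combination κ {y} {c} {p} y≡ = begin
  sumF (λ i → κ i * y i)                          ≡⟨ sumF-cong (λ i → cong (κ i *_) (y≡ i)) ⟩
  sumF (λ i → κ i * sumF (λ j → c j * p j i))     ≡⟨ sumF-cong (λ i → sym (sumF-*ˡ (κ i) (λ j → c j * p j i))) ⟩
  sumF (λ i → sumF (λ j → κ i * (c j * p j i)))   ≡⟨ sumF-comm (λ i j → κ i * (c j * p j i)) ⟩
  sumF (λ j → sumF (λ i → κ i * (c j * p j i)))   ≡⟨ sumF-cong (λ j → trans (sumF-cong (λ i → swap (κ i) (c j) (p j i)))
                                                                          (sumF-*ˡ (c j) (λ i → κ i * p j i))) ⟩
  sumF (λ j → c j * (κ · p j))                    ∎
  where
  open ≡-Reasoning
  swap : ∀ x y z → x * (y * z) ≡ y * (x * z)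
  swap = solve 3 (λ x y z → x :* (y :* z) := y :* (x :* z)) refl

convex-const : ∀ {m} {l : Fin m → ℚ} → sumF l ≡ 1ℚ → ∀ c → sumF (λ i → l i * c) ≡ c
convex-const {l = l} ∑l≡1 c = trans (sumF-*ʳ c l) (trans (cong (_* c) ∑l≡1) (ℚₚ.*-identityˡ c))

convex-≤ : ∀ {m} {l f : Fin m → ℚ} {c} → (∀ i → 0ℚ ≤ℚ l i) → sumF l ≡ 1ℚ →
           (∀ i → f i ≤ℚ c) → sumF (λ i → l i * f i) ≤ℚ c
convex-≤ {l = l} {f} {c} l≥0 ∑l≡1 f≤c = subst (sumF (λ i → l i * f i) ≤ℚ_) (convex-const {l = l} ∑l≡1 c)
  (sumF-mono (λ i → ℚₚ.*-monoˡ-≤-nonNeg (l i) {{nonNegative (l≥0 i)}} (f≤c i)))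

convex-support : ∀ {m} {l f : Fin m → ℚ} {c} → (∀ i → 0ℚ ≤ℚ l i) → sumF l ≡ 1ℚ →
                 (∀ i → f i ≤ℚ c) → c ≤ℚ sumF (λ i → l i * f i) → ∀ i → f i <ℚ c → l i ≡ 0ℚ
convex-support {l = l} {f} {c} l≥0 ∑l≡1 f≤c c≤avg i fi<c =
  ℚₚ.≤-antisym (ℚₚ.*-cancelʳ-≤-pos (c - f i) {{positive gapᵢ>0}} lᵢgapᵢ≤0) (l≥0 i)
  where
  gap : Fin _ → ℚ
  gap j = l j * (c - f j)
  gap≥0 : ∀ j → 0ℚ ≤ℚ gap j
  gap≥0 j = ℚₚ.nonNegative⁻¹ (gap j)
    {{ℚₚ.nonNeg*nonNeg⇒nonNeg (l j) {{nonNegative (l≥0 j)}} (c - f j) {{nonNegative (p≤q⇒0≤q-p (f≤c j))}}}}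
  gapᵢ>0 : 0ℚ <ℚ c - f i
  gapᵢ>0 = p<q⇒0<q-p fi<c
  ∑gap≡ : sumF gap ≡ c - sumF (λ j → l j * f j)
  ∑gap≡ = begin
    sumF gap
      ≡⟨ sumF-cong (λ j → distrib (l j) c (f j)) ⟩
    sumF (λ j → l j * c - l j * f j)
      ≡⟨ sumF-- (λ j → l j * c) (λ j → l j * f j) ⟩
    sumF (λ j → l j * c) - sumF (λ j → l j * f j)
      ≡⟨ cong (_- sumF (λ j → l j * f j)) (convex-const {l = l} ∑l≡1 c) ⟩
    c - sumF (λ j → l j * f j)     ∎
    where
    open ≡-Reasoning
    distrib : ∀ x y z → x * (y - z) ≡ x * y - x * z
    distrib = solve 3 (λ x y z → x :* (y :- z) := x :* y :- x :* z) refl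
  lᵢgapᵢ≤0 : l i * (c - f i) ≤ℚ 0ℚ * (c - f i)
  lᵢgapᵢ≤0 = begin
    gap i                        ≤⟨ term≤sumF gap≥0 i ⟩
    sumF gap                     ≡⟨ ∑gap≡ ⟩
    c - sumF (λ j → l j * f j)   ≤⟨ ℚₚ.+-monoʳ-≤ c (ℚₚ.neg-antimono-≤ c≤avg) ⟩
    c - c                        ≡⟨ ℚₚ.+-inverseʳ c ⟩
    0ℚ                           ≡⟨ sym (ℚₚ.*-zeroˡ (c - f i)) ⟩
    0ℚ * (c - f i)               ∎
    where open ℚₚ.≤-Reasoning

vert∈P : ∀ {n} (i : Fin n) → inP (vert i)
vert∈P i = 𝐞 i , (λ j → 𝟙-nonNeg _) , ∑𝐞≡1 , λ x → sym (𝐞·-select i (λ j → vert j x))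
  where
  ∑𝐞≡1 : sumF (𝐞 i) ≡ 1ℚ
  ∑𝐞≡1 = trans (sumF-cong (λ j → sym (ℚₚ.*-identityʳ (𝐞 i j)))) (𝐞·-select i (λ _ → 1ℚ))

·-inP : ∀ {n} (w : Vecℚ (suc n)) {y : Vecℚ (suc n)} {l : Fin n → ℚ} → sumF l ≡ 1ℚ →
        (∀ j → y j ≡ sumF (λ i → l i * vert i j)) → w · y ≡ w · γ₀ + sumF (λ i → l i * δ i w)
·-inP w {y} {l} ∑l≡1 y≡ = begin
  w · y
    ≡⟨ ·-combination w {c = l} {p = vert} y≡ ⟩
  sumF (λ i → l i * (w · vert i))
    ≡⟨ sumF-cong (λ i → trans (cong (l i *_) (·vert w i)) (ℚₚ.*-distribˡ-+ (l i) (w · γ₀) (δ i w))) ⟩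
  sumF (λ i → l i * (w · γ₀) + l i * δ i w)
    ≡⟨ sumF-+ (λ i → l i * (w · γ₀)) (λ i → l i * δ i w) ⟩
  sumF (λ i → l i * (w · γ₀)) + sumF (λ i → l i * δ i w)
    ≡⟨ cong (_+ sumF (λ i → l i * δ i w)) (convex-const {l = l} ∑l≡1 (w · γ₀)) ⟩
  w · γ₀ + sumF (λ i → l i * δ i w)
    ∎
  where open ≡-Reasoning

·-inP-≤ : ∀ {n} (w : Vecℚ (suc n)) {y m} → (∀ i → δ i w ≤ℚ m) → inP y → w · y ≤ℚ w · γ₀ + m
·-inP-≤ w δ≤m (l , l≥0 , ∑l≡1 , y≡) =
  subst (_≤ℚ _) (sym (·-inP w ∑l≡1 y≡)) (ℚₚ.+-monoʳ-≤ (w · γ₀) (convex-≤ l≥0 ∑l≡1 δ≤m))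

-- The normal fan of P

record Maximisers {n} (u : Vecℚ (suc n)) (B : Subset n) (c : ℚ) : Set where
  field
    on-B  : ∀ {i} → i ∈ B → δ i u ≡ c
    off-B : ∀ {i} → i ∉ B → δ i u <ℚ c
open Maximisers

maximisers-bound : ∀ {n} {u : Vecℚ (suc n)} {B c} → Maximisers u B c → ∀ i → δ i u ≤ℚ c
maximisers-bound {B = B} M i with i ∈? B
... | yes i∈B = ℚₚ.≤-reflexive (on-B M i∈B)
... | no  i∉B = ℚₚ.<⇒≤ (off-B M i∉B)

ν-max : ∀ {n} {B : Subset n} {w} → ν B w → ∀ {i} → i ∈ B → ∀ j → δ j w ≤ℚ δ i w
ν-max {B = B} (δ≡ , δ≤) i∈B j with j ∈? B
... | yes j∈B = ℚₚ.≤-reflexive (δ≡ j _ j∈B i∈B)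
... | no  j∉B = δ≤ j _ j∉B i∈B

*-agree-on-support : ∀ {n} {B : Subset n} {l f g : Fin n → ℚ} → (∀ i → i ∉ B → l i ≡ 0ℚ) →
                     (∀ i → i ∈ B → f i ≡ g i) → ∀ i → l i * f i ≡ l i * g i
*-agree-on-support {B = B} {l} {f} {g} l≡0 f≡g i with i ∈? B
... | yes i∈B = cong (l i *_) (f≡g i i∈B)
... | no  i∉B = begin
  l i * f i   ≡⟨ cong (_* f i) (l≡0 i i∉B) ⟩
  0ℚ * f i    ≡⟨ ℚₚ.*-zeroˡ (f i) ⟩
  0ℚ          ≡⟨ sym (ℚₚ.*-zeroˡ (g i)) ⟩
  0ℚ * g i    ≡⟨ cong (_* g i) (sym (l≡0 i i∉B)) ⟩
  l i * g i   ∎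
  where open ≡-Reasoning

module _ {n} {u : Vecℚ (suc n)} {B : Subset n} {c} (M : Maximisers u B c) where

  vert∈Face : ∀ {i} → i ∈ B → Face u (vert i)
  vert∈Face {i} i∈B = vert∈P i , λ y′ y′∈P →
    subst (u · y′ ≤ℚ_) (sym (trans (·vert u i) (cong (u · γ₀ +_) (on-B M i∈B))))
      (·-inP-≤ u (maximisers-bound M) y′∈P)

  normalCone⇒ν : ∀ {w} → NormalCone (Face u) w → ν B w
  normalCone⇒ν {w} w∈N = (λ i j i∈B j∈B → ℚₚ.≤-antisym (δ≤ j∈B i) (δ≤ i∈B j)) , (λ i j _ j∈B → δ≤ j∈B i)
    where
    δ≤ : ∀ {i} → i ∈ B → ∀ j → δ j w ≤ℚ δ i w
    δ≤ {i} i∈B j = +-cancelˡ-≤ (w · γ₀)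
      (subst₂ _≤ℚ_ (·vert w j) (·vert w i) (w∈N (vert i) (vert j) (vert∈Face i∈B) (vert∈P j)))

  ν⇒normalCone : ∀ {b} → b ∈ B → ∀ {w} → ν B w → NormalCone (Face u) w
  ν⇒normalCone {b} b∈B {w} w∈ν y y′ ((l , l≥0 , ∑l≡1 , y≡) , y-max) y′∈P = begin
    w · y′                                ≤⟨ ·-inP-≤ w (ν-max {B = B} {w} w∈ν b∈B) y′∈P ⟩
    w · γ₀ + δ b w                        ≡⟨ cong (w · γ₀ +_) (sym avg-δw) ⟩
    w · γ₀ + sumF (λ i → l i * δ i w)     ≡⟨ sym (·-inP w ∑l≡1 y≡) ⟩
    w · y                                 ∎
    where
    open ℚₚ.≤-Reasoning
    c≤avg-δu : c ≤ℚ sumF (λ i → l i * δ i u)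
    c≤avg-δu = +-cancelˡ-≤ (u · γ₀) (subst₂ _≤ℚ_
      (trans (·vert u b) (cong (u · γ₀ +_) (on-B M b∈B))) (·-inP u ∑l≡1 y≡)
      (y-max (vert b) (vert∈P b)))
    l≡0 : ∀ i → i ∉ B → l i ≡ 0ℚ
    l≡0 i i∉B = convex-support l≥0 ∑l≡1 (maximisers-bound M) c≤avg-δu i (off-B M i∉B)
    avg-δw : sumF (λ i → l i * δ i w) ≡ δ b w
    avg-δw = trans (sumF-cong (*-agree-on-support l≡0 (λ i i∈B → proj₁ w∈ν i b i∈B b∈B)))
                   (convex-const {l = l} ∑l≡1 (δ b w))

  normalCone≐ν : Nonempty B → NormalCone (Face u) ≐ ν B
  normalCone≐ν (b , b∈B) w = normalCone⇒ν {w} , ν⇒normalCone b∈B {w}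

subset : ∀ {n} {P : Pred (Fin n) 0ℓ} → Decidable P → Subset n
subset P? = tabulate (λ i → does (P? i))

∈-subset⁺ : ∀ {n} {P : Pred (Fin n) 0ℓ} (P? : Decidable P) {i} → P i → i ∈ subset P?
∈-subset⁺ P? {i} p = Vecₚ.lookup⇒[]= i _ (trans (Vecₚ.lookup∘tabulate (λ j → does (P? j)) i) (dec-true (P? i) p))

∈-subset⁻ : ∀ {n} {P : Pred (Fin n) 0ℓ} (P? : Decidable P) {i} → i ∈ subset P? → P i
∈-subset⁻ P? {i} i∈ with P? i | trans (sym (Vecₚ.lookup∘tabulate (λ j → does (P? j)) i)) (Vecₚ.[]=⇒lookup i∈)
... | yes p | _ = p
... | no  _ | ()

argmax : ∀ {m} (f : Fin (suc m) → ℚ) → ∃ λ b → ∀ i → f i ≤ℚ f b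
argmax {zero}  f = zero , λ { zero → ℚₚ.≤-refl }
argmax {suc m} f with argmax (λ i → f (suc i))
... | b , f≤fb with ℚₚ.≤-total (f zero) (f (suc b))
...   | inj₁ f₀≤fb = suc b , λ { zero → f₀≤fb ; (suc i) → f≤fb i }
...   | inj₂ fb≤f₀ = zero , λ { zero → ℚₚ.≤-refl ; (suc i) → ℚₚ.≤-trans (f≤fb i) fb≤f₀ }

maximisers-exist : ∀ {n} (u : Vecℚ (suc (suc n))) → ∃₂ λ B c → Nonempty B × Maximisers u B c
maximisers-exist u with argmax (λ i → δ i u)
... | b , δ≤δb = B , δ b u , (b , ∈-subset⁺ reaches ℚₚ.≤-refl) , record { on-B = on ; off-B = off }
  where
  reaches : Decidable (λ i → δ b u ≤ℚ δ i u)
  reaches i = δ b u ℚₚ.≤? δ i u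
  B = subset reaches
  on : ∀ {i} → i ∈ B → δ i u ≡ δ b u
  on {i} i∈B = ℚₚ.≤-antisym (δ≤δb i) (∈-subset⁻ reaches i∈B)
  off : ∀ {i} → i ∉ B → δ i u <ℚ δ b u
  off {i} i∉B = ℚₚ.≰⇒> (λ δb≤δi → i∉B (∈-subset⁺ reaches δb≤δi))

maximisers-indicator : ∀ {n} (B : Subset n) → Maximisers (partialSums (indicator B)) B 1ℚ
maximisers-indicator B = record
  { on-B  = λ {i} i∈B → trans (δ-partialSums (indicator B) i) (cong 𝟙 (dec-true (i ∈? B) i∈B))
  ; off-B = λ {i} i∉B → subst (_<ℚ 1ℚ) (sym (trans (δ-partialSums (indicator B) i) (cong 𝟙 (dec-false (i ∈? B) i∉B))))
                          (ℚₚ.positive⁻¹ 1ℚ)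
  }

-- Relative interiors

≐-refl : ∀ {d} {C : Cone d} → C ≐ C
≐-refl w = (λ x → x) , (λ x → x)

≐-sym : ∀ {d} {C D : Cone d} → C ≐ D → D ≐ C
≐-sym C≐D w = proj₂ (C≐D w) , proj₁ (C≐D w)

≐-trans : ∀ {d} {C D E : Cone d} → C ≐ D → D ≐ E → C ≐ E
≐-trans C≐D D≐E w = (λ x → proj₁ (D≐E w) (proj₁ (C≐D w) x)) , (λ x → proj₂ (C≐D w) (proj₂ (D≐E w) x))

relint-resp-≐ : ∀ {d} {C D : Cone d} {w} → C ≐ D → relint C w → relint D w
relint-resp-≐ {w = w} C≐D (w∈C , ε , ε>0 , ball) = proj₁ (C≐D w) w∈C , ε , ε>0 ,
  λ y (m , c , p , p∈D , ∑c≡1 , y≡) close → proj₁ (C≐D y)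
    (ball y (m , c , p , (λ j → proj₂ (C≐D (p j)) (p∈D j)) , ∑c≡1 , y≡) close)

aff-preserves-· : ∀ {d} {C : Cone d} (κ κ′ : Vecℚ d) → (∀ p → C p → κ · p ≡ κ′ · p) →
                  ∀ {y} → aff C y → κ · y ≡ κ′ · y
aff-preserves-· κ κ′ C⇒≡ {y} (m , c , p , p∈C , _ , y≡) = begin
  κ · y                           ≡⟨ ·-combination κ {c = c} {p = p} y≡ ⟩
  sumF (λ j → c j * (κ · p j))    ≡⟨ sumF-cong (λ j → cong (c j *_) (C⇒≡ (p j) (p∈C j))) ⟩
  sumF (λ j → c j * (κ′ · p j))   ≡⟨ sym (·-combination κ′ {c = c} {p = p} y≡) ⟩
  κ′ · y                          ∎
  where open ≡-Reasoning

-- w + t·𝟙_b = (1 + t) w − t (w − 𝟙_b) lies in the affine hull of C, within t of w.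
relint-push : ∀ {d} {C : Cone d} {w} (b : Fin d → Bool) → relint C w → C (λ x → w x - 𝟙 (b x)) →
              ∃ λ t → 0ℚ <ℚ t × C (λ x → w x + t * 𝟙 (b x))
relint-push {d} {C} {w} b (w∈C , ε , ε>0 , ball) w-𝟙∈C with ℚₚ.<-dense ε>0
... | t , t>0 , t<ε = t , t>0 , ball _ (2 , coeff , point , point∈C , ∑coeff≡1 , combination) close
  where
  coeff : Fin 2 → ℚ
  coeff zero       = 1ℚ + t
  coeff (suc zero) = - t
  point : Fin 2 → Vecℚ d
  point zero       = w
  point (suc zero) = λ x → w x - 𝟙 (b x)
  point∈C : ∀ j → C (point j)
  point∈C zero       = w∈C
  point∈C (suc zero) = w-𝟙∈C
  ∑coeff≡1 : sumF coeff ≡ 1ℚ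
  ∑coeff≡1 = solve 1 (λ t → (con 1ℚ :+ t) :+ (:- t :+ con 0ℚ) := con 1ℚ) refl t
  combination : ∀ x → w x + t * 𝟙 (b x) ≡ sumF (λ j → coeff j * point j x)
  combination x = solve 3 (λ w h t → w :+ t :* h := (con 1ℚ :+ t) :* w :+ ((:- t) :* (w :- h) :+ con 0ℚ))
                    refl (w x) (𝟙 (b x)) t
  close : ∀ x → ∣ (w x + t * 𝟙 (b x)) - w x ∣ <ℚ ε
  close x with b x
  ... | false = subst (λ z → ∣ z ∣ <ℚ ε) (sym (solve 2 (λ w t → (w :+ t :* con 0ℚ) :- w := con 0ℚ) refl (w x) t)) ε>0
  ... | true  = subst (λ z → ∣ z ∣ <ℚ ε) (sym (solve 2 (λ w t → (w :+ t :* con 1ℚ) :- w := t) refl (w x) t))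
                  (subst (_<ℚ ε) (sym (ℚₚ.0≤p⇒∣p∣≡p (ℚₚ.<⇒≤ t>0))) t<ε)

¼ : ℚ
¼ = ½ * ½

¼<½ : ¼ <ℚ ½
¼<½ = from-yes (¼ ℚₚ.<? ½)

δ-close : ∀ {n} {y w : Vecℚ (suc n)} → (∀ x → ∣ y x - w x ∣ <ℚ ¼) → ∀ i → ∣ δ i y - δ i w ∣ <ℚ ½
δ-close {y = y} {w} close i = begin-strict
  ∣ δ i y - δ i w ∣                  ≡⟨ cong ∣_∣ (sym (δ-- y w i)) ⟩
  ∣ Δsuc - Δinj ∣                    ≤⟨ ℚₚ.∣p-q∣≤∣p∣+∣q∣ Δsuc Δinj ⟩
  ∣ Δsuc ∣ + ∣ Δinj ∣                <⟨ ℚₚ.+-mono-< (close (suc i)) (close (inject₁ i)) ⟩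
  ½                                  ∎
  where
  open ℚₚ.≤-Reasoning
  Δsuc = y (suc i) - w (suc i)
  Δinj = y (inject₁ i) - w (inject₁ i)

-- Equalities pass to the affine hull; gaps of 1 survive in a ¼-ball, where each δᵢ moves by less than ½.
relint-σ : ∀ {d} (S : OSP d) {w : Vecℚ d} → (∀ x z → blk S x ≡ blk S z → w x ≡ w z) →
           (∀ x z → blk S x Fin.< blk S z → w x + 1ℚ ≤ℚ w z) → relint (σ S) w
relint-σ S {w} w≡ gap = (w≡ , λ x z x<z → p+1≤q⇒p≤q (gap x z x<z)) , ¼ , ℚₚ.positive⁻¹ ¼ , ball
  where
  ball : ∀ y → aff (σ S) y → (∀ x → ∣ y x - w x ∣ <ℚ ¼) → σ S y
  ball y y∈aff close = y≡ , λ x z x<z → gap-stable (gap x z x<z) (½-close x) (½-close z)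
    where
    ½-close : ∀ x → ∣ y x - w x ∣ <ℚ ½
    ½-close x = ℚₚ.<-trans (close x) ¼<½
    y≡ : ∀ x z → blk S x ≡ blk S z → y x ≡ y z
    y≡ x z same = subst₂ _≡_ (𝐞·-select x y) (𝐞·-select z y) (aff-preserves-· {C = σ S} (𝐞 x) (𝐞 z)
      (λ p p∈σ → trans (𝐞·-select x p) (trans (proj₁ p∈σ x z same) (sym (𝐞·-select z p)))) y∈aff)

relint-ν : ∀ {n} (B : Subset n) {w : Vecℚ (suc n)} → (∀ i j → i ∈ B → j ∈ B → δ i w ≡ δ j w) →
           (∀ i j → i ∉ B → j ∈ B → δ i w + 1ℚ ≤ℚ δ j w) → relint (ν B) w
relint-ν B {w} δ≡ gap = (δ≡ , λ i j i∉B j∈B → p+1≤q⇒p≤q (gap i j i∉B j∈B)) , ¼ , ℚₚ.positive⁻¹ ¼ , ball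
  where
  a·≡δ : ∀ i p → a i · p ≡ δ i p
  a·≡δ i p = trans (·-comm (a i) p) (·a≡δ p i)
  ball : ∀ y → aff (ν B) y → (∀ x → ∣ y x - w x ∣ <ℚ ¼) → ν B y
  ball y y∈aff close = y≡ , λ i j i∉B j∈B →
    gap-stable (gap i j i∉B j∈B) (δ-close {y = y} {w} close i) (δ-close {y = y} {w} close j)
    where
    y≡ : ∀ i j → i ∈ B → j ∈ B → δ i y ≡ δ j y
    y≡ i j i∈B j∈B = subst₂ _≡_ (a·≡δ i y) (a·≡δ j y) (aff-preserves-· {C = ν B} (a i) (a j)
      (λ p p∈ν → trans (a·≡δ i p) (trans (proj₁ p∈ν i j i∈B j∈B) (sym (a·≡δ j p)))) y∈aff)

-- Lowering w by a 0/1 step function keeps it in the cone, so by relint-push it can also be raised by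
-- some t > 0; the cone inequality at the raised point is the original one with a margin of t.
relint-σ-strict : ∀ {d} {S : OSP d} {w} → relint (σ S) w → ∀ {x z} → blk S x Fin.< blk S z → w x <ℚ w z
relint-σ-strict {d} {S} {w} w∈σ° {x} {z} x<z = conclude (relint-push {C = σ S} below-z w∈σ° lowered)
  where
  below-z : Fin d → Bool
  below-z y = does (toℕ (blk S y) <? toℕ (blk S z))
  lowered : σ S (λ y → w y - 𝟙 (below-z y))
  lowered = (λ p q same → cong₂ _-_ (proj₁ (proj₁ w∈σ°) p q same) (cong (λ b → 𝟙 (does (toℕ b <? toℕ (blk S z)))) same))
          , (λ p q p<q → ℚₚ.+-mono-≤ (proj₂ (proj₁ w∈σ°) p q p<q) (ℚₚ.neg-antimono-≤
              (𝟙-mono (ℕₚ.<-trans p<q) (toℕ (blk S q) <? toℕ (blk S z)) (toℕ (blk S p) <? toℕ (blk S z)))))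
  conclude : (∃ λ t → 0ℚ <ℚ t × σ S (λ y → w y + t * 𝟙 (below-z y))) → w x <ℚ w z
  conclude (t , t>0 , (_ , raised-ordered)) = p+t*1≤q+t*0⇒p<q t>0
    (subst₂ (λ b b′ → w x + t * 𝟙 b ≤ℚ w z + t * 𝟙 b′)
      (dec-true (toℕ (blk S x) <? toℕ (blk S z)) x<z) (dec-false (toℕ (blk S z) <? toℕ (blk S z)) (ℕₚ.<-irrefl refl))
      (raised-ordered x z x<z))

relint-ν-strict : ∀ {n} {B : Subset n} {w} → relint (ν B) w → ∀ {i j} → j ∉ B → i ∈ B → δ j w <ℚ δ i w
relint-ν-strict {n} {B} {w} w∈ν° {i} {j} j∉B i∈B = conclude (relint-push {C = ν B} (after j) w∈ν° lowered)
  where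
  H : Vecℚ (suc n)
  H x = 𝟙 (after j x)
  ≢j : ∀ {k} → k ∈ B → k ≢ j
  ≢j k∈B k≡j = j∉B (subst (_∈ B) k≡j k∈B)
  unmoved : ∀ {k} → k ∈ B → δ k (λ x → w x - H x) ≡ δ k w
  unmoved {k} k∈B = begin
    δ k (λ x → w x - H x)     ≡⟨ δ-- w H k ⟩
    δ k w - δ k H             ≡⟨ cong (λ z → δ k w - z) (trans (δ-𝟙after j k) (cong 𝟙 (dec-false (k Fin.≟ j) (≢j k∈B)))) ⟩
    δ k w - 0ℚ                ≡⟨ ℚₚ.+-identityʳ (δ k w) ⟩
    δ k w                     ∎
    where open ≡-Reasoning
  lowered : ν B (λ x → w x - H x)
  lowered = (λ p q p∈B q∈B → trans (unmoved p∈B) (trans (proj₁ (proj₁ w∈ν°) p q p∈B q∈B) (sym (unmoved q∈B))))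
          , (λ p q p∉B q∈B → subst₂ _≤ℚ_ (sym (δ-- w H p)) (sym (unmoved q∈B))
              (ℚₚ.≤-trans (lowered≤ p) (proj₂ (proj₁ w∈ν°) p q p∉B q∈B)))
    where
    lowered≤ : ∀ p → δ p w - δ p H ≤ℚ δ p w
    lowered≤ p = subst (λ z → δ p w - z ≤ℚ δ p w) (sym (δ-𝟙after j p)) (p-𝟙≤p (δ p w) (does (p Fin.≟ j)))
  raised : ∀ {t} k {b} → does (k Fin.≟ j) ≡ b → δ k (λ x → w x + t * H x) ≡ δ k w + t * 𝟙 b
  raised {t} k eq = trans (δ-+* w H t k) (cong (λ z → δ k w + t * z) (trans (δ-𝟙after j k) (cong 𝟙 eq)))
  conclude : (∃ λ t → 0ℚ <ℚ t × ν B (λ x → w x + t * H x)) → δ j w <ℚ δ i w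
  conclude (t , t>0 , (_ , raised-ordered)) = p+t*1≤q+t*0⇒p<q t>0
    (subst₂ _≤ℚ_ (raised {t} j (dec-true (j Fin.≟ j) refl)) (raised {t} i (dec-false (i Fin.≟ j) (≢j i∈B)))
      (raised-ordered j i j∉B i∈B))

σ-flat : ∀ {n} {S : OSP (suc n)} {w} → σ S w → ∀ {i} → blk S (suc i) ≡ blk S (inject₁ i) → δ i w ≡ 0ℚ
σ-flat {w = w} (w≡ , _) {i} same = trans (cong (_- w (inject₁ i)) (w≡ _ _ same)) (ℚₚ.+-inverseʳ (w (inject₁ i)))

Boundary : ∀ {n} → OSP (suc n) → Fin n → Set
Boundary S i = toℕ (blk S (suc i)) ≡ suc (toℕ (blk S (inject₁ i)))

relint-σ-rises : ∀ {n} {S : OSP (suc n)} {w} → relint (σ S) w → ∀ {i} → Boundary S i → 0ℚ <ℚ δ i w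
relint-σ-rises {S = S} w∈σ° {i} ∂i =
  p<q⇒0<q-p (relint-σ-strict {S = S} w∈σ° (subst (toℕ (blk S (inject₁ i)) <_) (sym ∂i) (ℕₚ.n<1+n _)))

-- Standard ordered set partitions

count : ∀ {d} {P : Pred (Fin d) 0ℓ} → Decidable P → ℕ
count P? = sumℕ (λ x → if does (P? x) then 1 else 0)

count-cong : ∀ {d} {P Q : Pred (Fin d) 0ℓ} (P? : Decidable P) (Q? : Decidable Q) →
             (∀ x → P x ⇔ Q x) → count P? ≡ count Q?
count-cong P? Q? P⇔Q = sumℕ-cong (λ x → cong (λ b → if b then 1 else 0) (does-⇔ (P⇔Q x) (P? x) (Q? x)))

count-mono : ∀ {d} {P Q : Pred (Fin d) 0ℓ} (P? : Decidable P) (Q? : Decidable Q) →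
             (∀ x → P x → Q x) → count P? ≤ count Q?
count-mono P? Q? P⇒Q = sumℕ-mono (λ x → pointwise (P? x) (Q? x) (P⇒Q x))
  where
  pointwise : ∀ {A B : Set} (A? : Dec A) (B? : Dec B) → (A → B) →
              (if does A? then 1 else 0) ≤ (if does B? then 1 else 0)
  pointwise (yes a) (yes _) _   = ℕₚ.≤-refl
  pointwise (yes a) (no ¬b) A⇒B = ⊥-elim (¬b (A⇒B a))
  pointwise (no _)  B?      _   = z≤n

count-< : ∀ {d} m → m ≤ d → count (λ (x : Fin d) → toℕ x <? m) ≡ m
count-< {zero}  zero    z≤n      = refl
count-< {suc d} zero    _        = trans (sumℕ≡sum {d} (λ _ → 0)) (∑ℕ.sum-replicate-zero d)
count-< {suc d} (suc m) (s≤s m≤d) = cong suc (count-< m m≤d)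

prefixSize≡count : ∀ {d} (S : OSP d) j → prefixSize S j ≡ count (λ x → toℕ (blk S x) <? j)
prefixSize≡count {d} S j = begin
  prefixSize S j
    ≡⟨ sumℕ≡sum (λ b → if before b then blockSize S b else 0) ⟩
  ∑ℕ.sum (λ b → if before b then blockSize S b else 0)
    ≡⟨ ∑ℕ.sum-cong-≗ (λ b → cong (λ s → if before b then s else 0) (sumℕ≡sum (λ x → inBlock x b))) ⟩
  ∑ℕ.sum (λ b → if before b then ∑ℕ.sum (λ x → inBlock x b) else 0)
    ≡⟨ ∑ℕ.sum-cong-≗ (λ b → if-sum (before b) (λ x → inBlock x b)) ⟩
  ∑ℕ.sum (λ b → ∑ℕ.sum (λ x → if before b then inBlock x b else 0))
    ≡⟨ ∑ℕ.∑-comm (λ b x → if before b then inBlock x b else 0) ⟩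
  ∑ℕ.sum (λ x → ∑ℕ.sum (λ b → if before b then inBlock x b else 0))
    ≡⟨ ∑ℕ.sum-cong-≗ (λ x → ∑ℕ.sum-cong-≗ (λ b → if-swap-then (before b) (does (blk S x Fin.≟ b)))) ⟩
  ∑ℕ.sum (λ x → ∑ℕ.sum (λ b → if does (blk S x Fin.≟ b) then 𝟙before b else 0))
    ≡⟨ ∑ℕ.sum-cong-≗ (λ x → sum-select (blk S x) 𝟙before) ⟩
  ∑ℕ.sum (λ x → 𝟙before (blk S x))
    ≡⟨ sym (sumℕ≡sum (λ x → 𝟙before (blk S x))) ⟩
  count (λ x → toℕ (blk S x) <? j) ∎
  where
  open ≡-Reasoning
  before : Fin (k S) → Bool
  before b = does (toℕ b <? j)
  𝟙before : Fin (k S) → ℕ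
  𝟙before b = if before b then 1 else 0
  inBlock : Fin d → Fin (k S) → ℕ
  inBlock x b = if does (blk S x Fin.≟ b) then 1 else 0

Fin1-≡ : ∀ {K} → K ≡ 1 → ∀ (p q : Fin K) → p ≡ q
Fin1-≡ refl zero zero = refl

constant-by-steps : ∀ {n} {A : Set} (f : Fin (suc n) → A) → (∀ i → f (suc i) ≡ f (inject₁ i)) → ∀ x → f x ≡ f zero
constant-by-steps {zero}  f steps zero    = refl
constant-by-steps {suc n} f steps zero    = refl
constant-by-steps {suc n} f steps (suc x) =
  trans (steps x) (constant-by-steps (λ y → f (inject₁ y)) (λ i → steps (inject₁ i)) x)

trivial-witness : ∀ {n} {S : OSP (suc n)} {B : Subset n} → IsTrivial S → (∀ i → i ∈ B) →
                  ∃ λ w → relint (σ S) w × relint (ν B) w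
trivial-witness {S = S} {B} trivial all∈B = (λ _ → 0ℚ)
  , relint-σ S {λ _ → 0ℚ} (λ _ _ _ → refl) (λ x z x<z → ⊥-elim (Finₚ.<⇒≢ x<z (Fin1-≡ trivial _ _)))
  , relint-ν B {λ _ → 0ℚ} (λ _ _ _ _ → refl) (λ i _ i∉B _ → ⊥-elim (i∉B (all∈B i)))

module StandardPartition {n : ℕ} (S : OSP (suc n)) (std : Standard S) where

  block : Fin (suc n) → ℕ
  block x = toℕ (blk S x)

  block-surj : ∀ {m} → m < k S → ∃ λ y → block y ≡ m
  block-surj m<k with surj S (fromℕ< m<k)
  ... | y , y∈m = y , trans (cong toℕ y∈m) (Finₚ.toℕ-fromℕ< m<k)

  block-<⇒< : ∀ {x z} → block x < block z → x Fin.< z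
  block-<⇒< {x} {z} = below (block z) refl
    where
    below : ∀ m {z} → block z ≡ m → block x < m → x Fin.< z
    below (suc m) {z} z∈m+1 (s≤s x≤m) with ℕₚ.m≤n⇒m<n∨m≡n x≤m
    ... | inj₂ x∈m = std x z (trans z∈m+1 (cong suc (sym x∈m)))
    ... | inj₁ x<m with block-surj (ℕₚ.<-trans (ℕₚ.n<1+n m) (subst (_< k S) z∈m+1 (Finₚ.toℕ<n (blk S z))))
    ...   | y , y∈m = ℕₚ.<-trans (below m y∈m x<m) (std y z (trans z∈m+1 (cong suc (sym y∈m))))

  block-mono : ∀ {x z} → toℕ x ≤ toℕ z → block x ≤ block z
  block-mono x≤z = ℕₚ.≮⇒≥ (λ z<x → ℕₚ.<⇒≱ (block-<⇒< z<x) x≤z)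

  block-step : ∀ i → blk S (suc i) ≡ blk S (inject₁ i) ⊎ Boundary S i
  block-step i with ℕₚ.<-cmp (block (suc i)) (suc (block (inject₁ i)))
  ... | tri< lt _ _ = inj₁ (Finₚ.toℕ-injective (ℕₚ.≤-antisym (ℕ.s≤s⁻¹ lt) (block-mono inject₁≤suc)))
    where
    inject₁≤suc : toℕ (inject₁ i) ≤ suc (toℕ i)
    inject₁≤suc = ℕₚ.m≤n⇒m≤1+n (ℕₚ.≤-reflexive (Finₚ.toℕ-inject₁ i))
  ... | tri≈ _ eq _ = inj₂ eq
  ... | tri> _ _ gt with block-surj (ℕₚ.<-trans gt (Finₚ.toℕ<n (blk S (suc i))))
  ...   | y , y∈next = ⊥-elim (ℕₚ.<⇒≱ i<y (ℕ.s≤s⁻¹ y<suc-i))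
    where
    i<y : toℕ i < toℕ y
    i<y = subst (_< toℕ y) (Finₚ.toℕ-inject₁ i)
            (block-<⇒< (subst (block (inject₁ i) <_) (sym y∈next) (ℕₚ.n<1+n _)))
    y<suc-i : toℕ y < suc (toℕ i)
    y<suc-i = block-<⇒< (subst (_< block (suc i)) (sym y∈next) gt)

  boundary-exists : ¬ IsTrivial S → ∃ (Boundary S)
  boundary-exists nontrivial with Finₚ.all? (λ i → blk S (suc i) Fin.≟ blk S (inject₁ i))
  ... | yes flat = ⊥-elim (ℕₚ.0≢1+n 0≡1)
    where
    1<k : 1 < k S
    1<k = ℕₚ.≤∧≢⇒< (ℕₚ.≤-<-trans z≤n (Finₚ.toℕ<n (blk S zero))) (λ 1≡k → nontrivial (sym 1≡k))
    0≡1 : 0 ≡ 1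
    0≡1 with block-surj (ℕₚ.<-trans (ℕₚ.n<1+n 0) 1<k) | block-surj 1<k
    ... | y₀ , y₀∈0 | y₁ , y₁∈1 = begin
      0               ≡⟨ sym y₀∈0 ⟩
      block y₀        ≡⟨ cong toℕ (constant-by-steps (blk S) flat y₀) ⟩
      block zero      ≡⟨ sym (cong toℕ (constant-by-steps (blk S) flat y₁)) ⟩
      block y₁        ≡⟨ y₁∈1 ⟩
      1               ∎
      where open ≡-Reasoning
  ... | no ¬flat with Finₚ.¬∀⟶∃¬ n _ (λ i → blk S (suc i) Fin.≟ blk S (inject₁ i)) ¬flat
  ...   | i , jump with block-step i
  ...     | inj₁ same = ⊥-elim (jump same)
  ...     | inj₂ ∂i   = i , ∂i

  #below : ℕ → ℕ
  #below j = count (λ x → block x <? j)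

  boundary⇒Type : ∀ {i} → Boundary S i → Type S (suc (toℕ i))
  boundary⇒Type {i} ∂i = block (suc i) , subst (1 ≤_) (sym ∂i) (s≤s z≤n) , Finₚ.toℕ<n (blk S (suc i)) , sym (begin
    prefixSize S (block (suc i))                         ≡⟨ prefixSize≡count S (block (suc i)) ⟩
    count (λ x → block x <? block (suc i))
      ≡⟨ count-cong (λ x → block x <? block (suc i)) (λ x → toℕ x <? suc (toℕ i)) before⇔≤i ⟩
    count (λ (x : Fin (suc n)) → toℕ x <? suc (toℕ i))   ≡⟨ count-< (suc (toℕ i)) (ℕₚ.<⇒≤ (Finₚ.toℕ<n (suc i))) ⟩
    suc (toℕ i)                                          ∎)
    where
    open ≡-Reasoning
    before⇔≤i : ∀ x → block x < block (suc i) ⇔ toℕ x < suc (toℕ i)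
    before⇔≤i x = mk⇔ block-<⇒< λ x≤i → subst (block x <_) (sym ∂i)
      (s≤s (block-mono (subst (toℕ x ≤_) (sym (Finₚ.toℕ-inject₁ i)) (ℕ.s≤s⁻¹ x≤i))))

  -- If i and i+1 share a block, the elements in blocks below j either include 0, …, i+1 or lie among 0, …, i-1.
  flat⇒#below≢ : ∀ {i} → blk S (suc i) ≡ blk S (inject₁ i) → ∀ j → #below j ≢ suc (toℕ i)
  flat⇒#below≢ {i} same j #below≡ with block (inject₁ i) <? j
  ... | yes i<j = ℕₚ.n≮n (suc (toℕ i)) (subst (suc (suc (toℕ i)) ≤_) #below≡
        (subst (_≤ #below j) (count-< (suc (suc (toℕ i))) (Finₚ.toℕ<n (suc i)))
          (count-mono (λ x → toℕ x <? suc (suc (toℕ i))) (λ x → block x <? j) up-to-i+1)))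
    where
    up-to-i+1 : ∀ x → toℕ x < suc (suc (toℕ i)) → block x < j
    up-to-i+1 x x≤i+1 = ℕₚ.≤-<-trans (subst (block x ≤_) (cong toℕ same) (block-mono (ℕ.s≤s⁻¹ x≤i+1))) i<j
  ... | no  i≮j = ℕₚ.n≮n (toℕ i) (subst (_≤ toℕ i) #below≡
        (subst (#below j ≤_) (count-< (toℕ i) (ℕₚ.<⇒≤ (ℕₚ.<-trans (Finₚ.toℕ<n i) (ℕₚ.n<1+n n))))
          (count-mono (λ x → block x <? j) (λ x → toℕ x <? toℕ i) below-i)))
    where
    below-i : ∀ x → block x < j → toℕ x < toℕ i
    below-i x x<j = ℕₚ.≰⇒> (λ i≤x → i≮j (ℕₚ.≤-<-trans (block-mono (subst (_≤ toℕ x) (sym (Finₚ.toℕ-inject₁ i)) i≤x)) x<j))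

  Type⇒boundary : ∀ {i} → Type S (suc (toℕ i)) → Boundary S i
  Type⇒boundary {i} (j , _ , _ , i+1≡prefix) with block-step i
  ... | inj₁ same = ⊥-elim (flat⇒#below≢ same j (sym (trans i+1≡prefix (prefixSize≡count S j))))
  ... | inj₂ ∂i   = ∂i

  module Witness (B : Subset n) (B⊆∂ : ∀ {i} → i ∈ B → Boundary S i) where

    β g w : Vecℚ (suc n)
    β x = fromℕ (block x)
    g   = partialSums (indicator B)
    w x = β x + g x

    δβ-flat : ∀ {i} → blk S (suc i) ≡ blk S (inject₁ i) → δ i β ≡ 0ℚ
    δβ-flat {i} same = trans (cong (λ b → fromℕ (toℕ b) - β (inject₁ i)) same) (ℚₚ.+-inverseʳ (β (inject₁ i)))

    δβ-boundary : ∀ {i} → Boundary S i → δ i β ≡ 1ℚ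
    δβ-boundary {i} ∂i = trans (cong (λ m → fromℕ m - β (inject₁ i)) ∂i)
      (solve 1 (λ x → (con 1ℚ :+ x) :- x := con 1ℚ) refl (β (inject₁ i)))

    δβ-bounds : ∀ i → 0ℚ ≤ℚ δ i β × δ i β ≤ℚ 1ℚ
    δβ-bounds i with block-step i
    ... | inj₁ same = subst (λ z → 0ℚ ≤ℚ z × z ≤ℚ 1ℚ) (sym (δβ-flat same)) (ℚₚ.≤-refl , 𝟙-nonNeg true)
    ... | inj₂ ∂i   = subst (λ z → 0ℚ ≤ℚ z × z ≤ℚ 1ℚ) (sym (δβ-boundary ∂i)) (𝟙-nonNeg true , ℚₚ.≤-refl)

    δg : ∀ i → δ i g ≡ indicator B i
    δg = δ-partialSums (indicator B)

    g-mono : ∀ {x z} → toℕ x ≤ toℕ z → g x ≤ℚ g z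
    g-mono = δ≥0⇒mono g (λ i → subst (0ℚ ≤ℚ_) (sym (δg i)) (𝟙-nonNeg _))

    β-g-mono : ∀ {x z} → toℕ x ≤ toℕ z → β x - g x ≤ℚ β z - g z
    β-g-mono = δ≥0⇒mono (λ x → β x - g x) δ≥0
      where
      δ≥0 : ∀ i → 0ℚ ≤ℚ δ i (λ x → β x - g x)
      δ≥0 i with i ∈? B
      ... | yes i∈B = subst (0ℚ ≤ℚ_) (sym (begin
                        δ i (λ x → β x - g x) ≡⟨ δ-- β g i ⟩
                        δ i β - δ i g         ≡⟨ cong₂ _-_ (δβ-boundary (B⊆∂ i∈B))
                                                           (trans (δg i) (cong 𝟙 (dec-true (i ∈? B) i∈B))) ⟩
                        1ℚ - 1ℚ               ≡⟨ ℚₚ.+-inverseʳ 1ℚ ⟩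
                        0ℚ                    ∎)) ℚₚ.≤-refl
        where open ≡-Reasoning
      ... | no  i∉B = subst (0ℚ ≤ℚ_) (sym (begin
                        δ i (λ x → β x - g x) ≡⟨ δ-- β g i ⟩
                        δ i β - δ i g         ≡⟨ cong (λ z → δ i β - z) (trans (δg i) (cong 𝟙 (dec-false (i ∈? B) i∉B))) ⟩
                        δ i β - 0ℚ            ≡⟨ ℚₚ.+-identityʳ (δ i β) ⟩
                        δ i β                 ∎)) (proj₁ (δβ-bounds i))
        where open ≡-Reasoning

    -- g and β − g both increase, and β is constant on a block, so g is too.
    g-const : ∀ {x z} → blk S x ≡ blk S z → toℕ x ≤ toℕ z → g x ≡ g z
    g-const {x} {z} same x≤z = ℚₚ.≤-antisym (g-mono x≤z) (+-cancelˡ-≤ (β z - g z - g x) (subst₂ _≤ℚ_ eqˡ eqʳ (β-g-mono x≤z)))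
      where
      βx≡βz : β x ≡ β z
      βx≡βz = cong (λ b → fromℕ (toℕ b)) same
      eqˡ : β x - g x ≡ (β z - g z - g x) + g z
      eqˡ = trans (cong (_- g x) βx≡βz) (solve 3 (λ b gx gz → b :- gx := (b :- gz :- gx) :+ gz) refl (β z) (g x) (g z))
      eqʳ : β z - g z ≡ (β z - g z - g x) + g x
      eqʳ = solve 3 (λ b gx gz → b :- gz := (b :- gz :- gx) :+ gx) refl (β z) (g x) (g z)

    w-const : ∀ x z → blk S x ≡ blk S z → w x ≡ w z
    w-const x z same with ℕₚ.≤-total (toℕ x) (toℕ z)
    ... | inj₁ x≤z = cong₂ _+_ (cong (λ b → fromℕ (toℕ b)) same) (g-const same x≤z)
    ... | inj₂ z≤x = cong₂ _+_ (cong (λ b → fromℕ (toℕ b)) same) (sym (g-const (sym same) z≤x))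

    w-gap : ∀ x z → blk S x Fin.< blk S z → w x + 1ℚ ≤ℚ w z
    w-gap x z x<z = subst (_≤ℚ w z) (solve 3 (λ b g o → (b :+ o) :+ g := (b :+ g) :+ o) refl (β x) (g x) 1ℚ)
      (ℚₚ.+-mono-≤ (fromℕ-+1≤ x<z) (g-mono (ℕₚ.<⇒≤ (block-<⇒< x<z))))

    δw : ∀ i → δ i w ≡ δ i β + indicator B i
    δw i = trans (δ-+ β g i) (cong (δ i β +_) (δg i))

    δw-on-B : ∀ {i} → i ∈ B → δ i w ≡ 1ℚ + 1ℚ
    δw-on-B {i} i∈B = trans (δw i) (cong₂ _+_ (δβ-boundary (B⊆∂ i∈B)) (cong 𝟙 (dec-true (i ∈? B) i∈B)))

    δw-gap : ∀ i j → i ∉ B → j ∈ B → δ i w + 1ℚ ≤ℚ δ j w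
    δw-gap i j i∉B j∈B = subst₂ _≤ℚ_
      (cong (_+ 1ℚ) (sym (trans (δw i) (cong (δ i β +_) (cong 𝟙 (dec-false (i ∈? B) i∉B))))))
      (sym (δw-on-B j∈B))
      (ℚₚ.+-monoˡ-≤ 1ℚ (subst (_≤ℚ 1ℚ) (sym (ℚₚ.+-identityʳ (δ i β))) (proj₂ (δβ-bounds i))))

    witness : ∃ λ w → relint (σ S) w × relint (ν B) w
    witness = w , relint-σ S w-const w-gap , relint-ν B (λ i j i∈B j∈B → trans (δw-on-B i∈B) (sym (δw-on-B j∈B))) δw-gap

  relint∩⇒Cond : ∀ (B : Subset n) → Nonempty B → (∃ λ w → relint (σ S) w × relint (ν B) w) → Cond S B
  relint∩⇒Cond B (b , b∈B) (w , w∈σ° , w∈ν°) with k S ℕ.≟ 1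
  ... | yes trivial = inj₁ (trivial , all∈B)
    where
    flat : ∀ i → δ i w ≡ 0ℚ
    flat i = σ-flat {S = S} (proj₁ w∈σ°) (Fin1-≡ trivial _ _)
    all∈B : ∀ i → i ∈ B
    all∈B i with i ∈? B
    ... | yes i∈B = i∈B
    ... | no  i∉B = ⊥-elim (ℚₚ.<-irrefl (trans (flat i) (sym (flat b))) (relint-ν-strict {B = B} w∈ν° i∉B b∈B))
  ... | no nontrivial = inj₂ (nontrivial , λ i i∈B → boundary⇒Type (B⊆∂ i∈B))
    where
    -- A flat step in B would force every step, including a rising boundary step, to be ≤ 0.
    B⊆∂ : ∀ {i} → i ∈ B → Boundary S i
    B⊆∂ {i} i∈B with block-step i | boundary-exists nontrivial
    ... | inj₂ ∂i   | _      = ∂i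
    ... | inj₁ same | j , ∂j = ⊥-elim (ℚₚ.<-irrefl refl (ℚₚ.<-≤-trans (relint-σ-rises {S = S} w∈σ° ∂j) δj≤0))
      where
      δj≤0 : δ j w ≤ℚ 0ℚ
      δj≤0 = subst (δ j w ≤ℚ_) (σ-flat {S = S} (proj₁ w∈σ°) same) (ν-max {B = B} {w} (proj₁ w∈ν°) i∈B j)

  Cond⇒relint∩ : ∀ {B} → Cond S B → ∃ λ w → relint (σ S) w × relint (ν B) w
  Cond⇒relint∩     (inj₁ (trivial , all∈B)) = trivial-witness {S = S} trivial all∈B
  Cond⇒relint∩ {B} (inj₂ (_ , B⊆Type))      = Witness.witness B (λ i∈B → Type⇒boundary (B⊆Type _ i∈B))

open StandardPartition using (relint∩⇒Cond; Cond⇒relint∩)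

InΩ⇒Cond : ∀ {n} {C φ : Cone (suc (suc n))} → InΩ C φ →
           Σ (OSP (suc (suc n))) λ S → Standard S × Σ (Subset (suc n)) λ B →
             Nonempty B × Cond S B × (C ≐ ν B) × (φ ≐ σ S)
InΩ⇒Cond {C = C} ((u , C≐N) , (S , std , φ≐σ) , w , w∈C° , w∈φ°) with maximisers-exist u
... | B , _ , B≢∅ , M =
  S , std , B , B≢∅ , relint∩⇒Cond S std B B≢∅ (w , relint-resp-≐ φ≐σ w∈φ° , relint-resp-≐ C≐ν w∈C°) , C≐ν , φ≐σ
  where
  C≐ν : C ≐ ν B
  C≐ν = ≐-trans C≐N (normalCone≐ν M B≢∅)

Cond⇒InΩ : ∀ {n} {S : OSP (suc n)} {B : Subset n} → Standard S → Nonempty B → Cond S B → InΩ (ν B) (σ S)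
Cond⇒InΩ {S = S} {B} std B≢∅ cond with Cond⇒relint∩ S std cond
... | w , w∈σ° , w∈ν° =
  (partialSums (indicator B) , ≐-sym (normalCone≐ν (maximisers-indicator B) B≢∅)) , (S , std , ≐-refl) , w , w∈ν° , w∈σ°

proposition6p21 :
  ∀ (n : ℕ) → 1 ≤ n →
    ( ∀ (S : OSP (suc n)) → Standard S → (B : Subset n) → Nonempty B →
        (∃[ w ] (relint (σ S) w × relint (ν B) w)) ⇔ Cond S B )
    × ( (∀ (C φ : Cone (suc n)) → InΩ C φ →
           Σ (OSP (suc n)) λ S → Standard S × Σ (Subset n) λ B →
             Nonempty B × Cond S B × (C ≐ ν B) × (φ ≐ σ S))
      × (∀ (S : OSP (suc n)) → Standard S → (B : Subset n) → Nonempty B →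
           Cond S B → InΩ (ν B) (σ S)) )
proposition6p21 zero    ()
proposition6p21 (suc n) _  =
    (λ S std B B≢∅ → mk⇔ (relint∩⇒Cond S std B B≢∅) (Cond⇒relint∩ S std))
  , (λ C φ → InΩ⇒Cond)
  , (λ S std B B≢∅ → Cond⇒InΩ {S = S} std B≢∅)
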